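{- Let $R$ be a pyramidal transit function on a non-empty finite set $V$. Then $R$ satisfies (u3): for all $x,y\in V$, if $R(x,y)\not\subseteq\{x,y\}$, then there exists $z\in R(x,y)\setminus\{x,y\}$ such that $R(x,z)\cup R(z,y)=R(x,y)$.
   Context: A transit function on $V$ is a map $R:V\times V\to 2^V$ with $u\in R(u,v)$, $R(u,v)=R(v,u)$, $R(u,u)=\{u\}$ for all $u,v\in V$; it is monotone if $p,q\in R(u,v)$ implies $R(p,q)\subseteq R(u,v)$. A monotone transit function $R$ is pyramidal if its transit sets $\{R(x,y)\mid x,y\in V\}$ are closed under non-empty intersection and there is a total order $<$ on $V$ such that each $R(x,y)$ is an interval w.r.t. $<$ (if $a,b\in R(x,y)$ and $a<w<b$ then $w\in R(x,y)$). -}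

module Defs where

open import Data.Nat using (ℕ; suc)
open import Data.Fin using (Fin)
open import Data.Fin.Subset using (Subset; _∈_; _⊆_; _∩_; _∪_; ⁅_⁆; Nonempty)
open import Data.Product using (Σ; ∃; ∃₂; _×_)
open import Relation.Binary.PropositionalEquality using (_≡_)
open import Relation.Binary.Structures using (IsStrictTotalOrder)

-- A map R : V × V → 2^V on the finite set V = Fin n
-- (subsets are represented by 'Subset n', i.e. characteristic vectors).
TransitMap : ℕ → Set
TransitMap n = Fin n → Fin n → Subset n

record IsTransit {n : ℕ} (R : TransitMap n) : Set where
  field
    self∈    : ∀ u v → u ∈ R u v
    symm     : ∀ u v → R u v ≡ R v u
    diagonal : ∀ u → R u u ≡ ⁅ u ⁆

IsMonotone : {n : ℕ} → TransitMap n → Set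
IsMonotone R = ∀ u v p q → p ∈ R u v → q ∈ R u v → R p q ⊆ R u v

-- transit sets closed under non-empty (pairwise, hence finite) intersection
IntersectionClosed : {n : ℕ} → TransitMap n → Set
IntersectionClosed R =
  ∀ x y x' y' → Nonempty (R x y ∩ R x' y') →
    ∃₂ λ a b → R a b ≡ (R x y ∩ R x' y')

AllIntervals : {n : ℕ} → TransitMap n → (Fin n → Fin n → Set) → Set
AllIntervals R _<_ =
  ∀ x y a b w → a ∈ R x y → b ∈ R x y → a < w → w < b → w ∈ R x y

record IsPyramidal {n : ℕ} (R : TransitMap n) : Set₁ where
  field
    transit      : IsTransit R
    monotone     : IsMonotone R
    interClosed  : IntersectionClosed R
    order        : Fin n → Fin n → Set
    totalOrder   : IsStrictTotalOrder _≡_ order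
    intervals    : AllIntervals R order

-- Only the interval property (w.r.t. the order) and monotonicity are needed.  Let z ∈ R(x,y) ∖ {x,y}.  If z does
-- not lie between x and y in the order, one of x, y lies between z and the other
-- endpoint, hence belongs to R(z,y) resp. R(x,z), and monotonicity makes that set
-- contain R(x,y).  If every element of R(x,y) ∖ {x,y} lies between x and y, any
-- such z works: each w ∈ R(x,y) lies between x and z or between z and y, so it
-- belongs to R(x,z) ∪ R(z,y) by the interval property.
module Submission where

open import Defs
open import Data.Nat using (ℕ; suc)
open import Data.Fin using (Fin)
open import Data.Fin.Properties using (_≟_; any?)
open import Data.Fin.Subset using (Subset; _∈_; _⊆_; _∪_; ⁅_⁆)
open import Data.Fin.Subset.Properties
  using (_∈?_; x∈⁅x⁆; x∈⁅y⁆⇒x≡y; x∈p∪q⁺; x∈p∪q⁻; p⊆p∪q; q⊆p∪q; ⊆-antisym)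
open import Data.Product using (∃; _×_; _,_)
open import Data.Sum using (_⊎_; inj₁; inj₂; [_,_]′)
open import Level using (Level; 0ℓ)
open import Relation.Binary.Core using (Rel)
open import Relation.Binary.Definitions using (tri<; tri≈; tri>)
open import Relation.Binary.PropositionalEquality using (_≡_; _≢_; refl; subst)
open import Relation.Binary.Structures using (IsStrictTotalOrder)
open import Relation.Nullary using (¬_; Dec; yes; no; contradiction)
open import Relation.Nullary.Decidable using (_×-dec_; _⊎-dec_; ¬?; decidable-stable)

∃-outside-pair : ∀ {n} {p : Subset n} (x y : Fin n) →
  ¬ (p ⊆ (⁅ x ⁆ ∪ ⁅ y ⁆)) → ∃ λ w → w ∈ p × w ≢ x × w ≢ y
∃-outside-pair {p = p} x y p⊈ with any? (λ w → (w ∈? p) ×-dec ¬? (w ≟ x) ×-dec ¬? (w ≟ y))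
... | yes found = found
... | no none = contradiction (λ {w} → p⊆ {w}) p⊈
  where
  p⊆ : p ⊆ (⁅ x ⁆ ∪ ⁅ y ⁆)
  p⊆ {w} w∈p with w ≟ x | w ≟ y
  ... | yes refl | _        = x∈p∪q⁺ (inj₁ (x∈⁅x⁆ x))
  ... | no _     | yes refl = x∈p∪q⁺ (inj₂ (x∈⁅x⁆ y))
  ... | no w≢x   | no w≢y   = contradiction (w , w∈p , w≢x , w≢y) none

module Betweenness {a ℓ : Level} {A : Set a} {_<_ : Rel A ℓ}
                   (sto : IsStrictTotalOrder _≡_ _<_) where

  open IsStrictTotalOrder sto using (compare; trans; asym; _<?_)

  Between : A → A → A → Set ℓ
  Between u v w = (u < w × w < v) ⊎ (v < w × w < u)

  between? : ∀ u v w → Dec (Between u v w)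
  between? u v w = ((u <? w) ×-dec (w <? v)) ⊎-dec ((v <? w) ×-dec (w <? u))

  between-split : ∀ {x y z w} → Between x y z → Between x y w →
                  w ≡ z ⊎ Between x z w ⊎ Between z y w
  between-split {z = z} {w} x-z-y x-w-y with compare w z
  between-split _ _ | tri≈ _ w≡z _ = inj₁ w≡z
  between-split (inj₁ (x<z , z<y)) (inj₁ (x<w , w<y)) | tri< w<z _ _ = inj₂ (inj₁ (inj₁ (x<w , w<z)))
  between-split (inj₁ (x<z , z<y)) (inj₁ (x<w , w<y)) | tri> _ _ z<w = inj₂ (inj₂ (inj₁ (z<w , w<y)))
  between-split (inj₂ (y<z , z<x)) (inj₂ (y<w , w<x)) | tri< w<z _ _ = inj₂ (inj₂ (inj₂ (y<w , w<z)))
  between-split (inj₂ (y<z , z<x)) (inj₂ (y<w , w<x)) | tri> _ _ z<w = inj₂ (inj₁ (inj₂ (z<w , w<x)))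
  between-split (inj₁ (x<z , z<y)) (inj₂ (y<w , w<x)) | _ = contradiction (trans y<w w<x) (asym (trans x<z z<y))
  between-split (inj₂ (y<z , z<x)) (inj₁ (x<w , w<y)) | _ = contradiction (trans x<w w<y) (asym (trans y<z z<x))

  ¬between⇒between-endpoint : ∀ {x y z} → x ≢ y → z ≢ x → z ≢ y → ¬ Between x y z →
                               Between z y x ⊎ Between x z y
  ¬between⇒between-endpoint {x} {y} {z} x≢y z≢x z≢y ¬x-z-y with compare z x | compare z y | compare x y
  ... | tri≈ _ z≡x _ | _              | _              = contradiction z≡x z≢x
  ... | _            | tri≈ _ z≡y _   | _              = contradiction z≡y z≢y
  ... | _            | _              | tri≈ _ x≡y _   = contradiction x≡y x≢y
  ... | tri< z<x _ _ | tri> _ _ y<z   | _              = contradiction (inj₂ (y<z , z<x)) ¬x-z-y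
  ... | tri> _ _ x<z | tri< z<y _ _   | _              = contradiction (inj₁ (x<z , z<y)) ¬x-z-y
  ... | tri< z<x _ _ | tri< _ _ _     | tri< x<y _ _   = inj₁ (inj₁ (z<x , x<y))
  ... | tri< _ _ _   | tri< z<y _ _   | tri> _ _ y<x   = inj₂ (inj₂ (z<y , y<x))
  ... | tri> _ _ _   | tri> _ _ y<z   | tri< x<y _ _   = inj₂ (inj₁ (x<y , y<z))
  ... | tri> _ _ x<z | tri> _ _ _     | tri> _ _ y<x   = inj₁ (inj₂ (y<x , x<z))

SatisfiesU3 : ∀ {n} → TransitMap n → Set
SatisfiesU3 R = ∀ x y → ¬ (R x y ⊆ (⁅ x ⁆ ∪ ⁅ y ⁆)) →
  ∃ λ z → z ∈ R x y × z ≢ x × z ≢ y × ((R x z ∪ R z y) ≡ R x y)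

module _ {n : ℕ} {R : TransitMap n} (isTransit : IsTransit R) (isMonotone : IsMonotone R)
         {_<_ : Rel (Fin n) 0ℓ} (sto : IsStrictTotalOrder _≡_ _<_)
         (allIntervals : AllIntervals R _<_) where

  open IsTransit isTransit
  open Betweenness sto

  self∈ʳ : ∀ u v → v ∈ R u v
  self∈ʳ u v = subst (v ∈_) (symm v u) (self∈ v u)

  ∈R-off-diagonal⇒≢ : ∀ {x y z} → z ∈ R x y → z ≢ x → x ≢ y
  ∈R-off-diagonal⇒≢ {x} z∈Rxx z≢x refl = z≢x (x∈⁅y⁆⇒x≡y x (subst (_ ∈_) (diagonal x) z∈Rxx))

  ∪-⊆ : ∀ {x y z} → z ∈ R x y → (R x z ∪ R z y) ⊆ R x y
  ∪-⊆ {x} {y} {z} z∈ w∈ =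
    [ isMonotone x y x z (self∈ x y) z∈ , isMonotone x y z y z∈ (self∈ʳ x y) ]′
      (x∈p∪q⁻ (R x z) (R z y) w∈)

  ∪≡ : ∀ {x y z} → z ∈ R x y → R x y ⊆ (R x z ∪ R z y) → (R x z ∪ R z y) ≡ R x y
  ∪≡ z∈ ⊇ = ⊆-antisym (∪-⊆ z∈) ⊇

  between⇒∈ : ∀ {u v w} → Between u v w → w ∈ R u v
  between⇒∈ {u} {v} {w} (inj₁ (u<w , w<v)) = allIntervals u v u v w (self∈ u v) (self∈ʳ u v) u<w w<v
  between⇒∈ {u} {v} {w} (inj₂ (v<w , w<u)) = allIntervals u v v u w (self∈ʳ u v) (self∈ u v) v<w w<u

  between⇒R⊆ˡ : ∀ {u v w} → Between u v w → R u w ⊆ R u v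
  between⇒R⊆ˡ {u} {v} {w} b = isMonotone u v u w (self∈ u v) (between⇒∈ b)

  between⇒R⊆ʳ : ∀ {u v w} → Between u v w → R w v ⊆ R u v
  between⇒R⊆ʳ {u} {v} {w} b = isMonotone u v w v (between⇒∈ b) (self∈ʳ u v)

  ⊆-∪-outside : ∀ {x y z} → z ∈ R x y → z ≢ x → z ≢ y → ¬ Between x y z →
                R x y ⊆ (R x z ∪ R z y)
  ⊆-∪-outside {x} {y} {z} z∈ z≢x z≢y ¬x-z-y
    with ¬between⇒between-endpoint (∈R-off-diagonal⇒≢ z∈ z≢x) z≢x z≢y ¬x-z-y
  ... | inj₁ z-x-y = λ w∈ → q⊆p∪q (R x z) (R z y) (between⇒R⊆ʳ z-x-y w∈)
  ... | inj₂ x-y-z = λ w∈ → p⊆p∪q (R z y) (between⇒R⊆ˡ x-y-z w∈)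

  ⊆-∪-inside : ∀ {x y z} → Between x y z →
               (∀ w → w ∈ R x y → w ≢ x → w ≢ y → Between x y w) →
               R x y ⊆ (R x z ∪ R z y)
  ⊆-∪-inside {x} {y} {z} x-z-y inside {w} w∈ with w ≟ x | w ≟ y
  ... | yes refl | _        = x∈p∪q⁺ (inj₁ (self∈ x z))
  ... | no _     | yes refl = x∈p∪q⁺ (inj₂ (self∈ʳ z y))
  ... | no w≢x   | no w≢y   with between-split x-z-y (inside w w∈ w≢x w≢y)
  ...   | inj₁ refl          = x∈p∪q⁺ (inj₁ (self∈ʳ x z))
  ...   | inj₂ (inj₁ x-w-z)  = x∈p∪q⁺ (inj₁ (between⇒∈ x-w-z))
  ...   | inj₂ (inj₂ z-w-y)  = x∈p∪q⁺ (inj₂ (between⇒∈ z-w-y))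

  monotone∧intervals⇒u3 : SatisfiesU3 R
  monotone∧intervals⇒u3 x y R⊈
    with any? (λ w → ((w ∈? R x y) ×-dec ¬? (w ≟ x) ×-dec ¬? (w ≟ y)) ×-dec ¬? (between? x y w))
  ... | yes (z , (z∈ , z≢x , z≢y) , ¬x-z-y) =
    z , z∈ , z≢x , z≢y , ∪≡ z∈ (⊆-∪-outside z∈ z≢x z≢y ¬x-z-y)
  ... | no noOutside with ∃-outside-pair x y R⊈
  ...   | z , z∈ , z≢x , z≢y = z , z∈ , z≢x , z≢y , ∪≡ z∈ (⊆-∪-inside (inside z z∈ z≢x z≢y) inside)
    where
    inside : ∀ w → w ∈ R x y → w ≢ x → w ≢ y → Between x y w
    inside w w∈ w≢x w≢y =
      decidable-stable (between? x y w) (λ ¬x-w-y → noOutside (w , (w∈ , w≢x , w≢y) , ¬x-w-y))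

mainTheorem14 : (n : ℕ) (R : TransitMap (suc n)) → IsPyramidal R →
    ∀ x y → ¬ (R x y ⊆ (⁅ x ⁆ ∪ ⁅ y ⁆)) →
    ∃ λ z → z ∈ R x y × z ≢ x × z ≢ y × ((R x z ∪ R z y) ≡ R x y)
mainTheorem14 n R P = monotone∧intervals⇒u3 transit monotone totalOrder intervals
  where open IsPyramidal P
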